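{- For every agent $a\in A$ and every $\varphi\in\mathcal L_\forall$ the following are valid: (i) $\forall_a\varphi\to\varphi$; (ii) $\forall_a\varphi\to\forall_a\forall_a\varphi$; (iii) $\exists_a\forall_a\varphi\to\forall_a\exists_a\varphi$; (iv) $\exists_a\Diamond_a\varphi\leftrightarrow\Diamond_a\exists_a\varphi$.
   Context: Fix a finite set $A$ of agents and a set $P$ of propositional variables. Models $M=(S,R,V)$ with $R_a\subseteq S\times S$ and $V:P\to\mathcal P(S)$; $sR_a=\{t\mid(s,t)\in R_a\}$. $M_s\succeq_a M'_{s'}$ iff there is a nonempty $\mathfrak F\subseteq S\times S'$ containing $(s,s')$ such that for all $(u,u')\in\mathfrak F$: $u\in V(p)$ iff $u'\in V'(p)$ for all $p$; for every $b\in A$ and $v'\in u'R'_b$ there is $v\in uR_b$ with $(v,v')\in\mathfrak F$; for every $b\in A\setminus\{a\}$ and $v\in uR_b$ there is $v'\in u'R'_b$ with $(v,v')\in\mathfrak F$. $\mathcal L_\forall$: $\varphi::=p\mid\neg\varphi\mid(\varphi\wedge\varphi)\mid\Box_a\varphi\mid\forall_a\varphi$; $M_s\models\Box_a\varphi$ iff $M_t\models\varphi$ for all $t\in sR_a$; $M_s\models\forall_a\varphi$ iff $M'_{s'}\models\varphi$ for every $M'_{s'}$ with $M_s\succeq_a M'_{s'}$; $\Diamond_a\varphi:=\neg\Box_a\neg\varphi$, $\exists_a\varphi:=\neg\forall_a\neg\varphi$. Valid means true at every pointed model (over the class of all models). -}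

module Defs where

open import Level using (Lift; lift) renaming (zero to lzero; suc to lsuc)
open import Data.Nat using (ℕ)
open import Data.Fin using (Fin)
open import Data.Product using (Σ; _×_; _,_)
open import Data.Empty using (⊥)
open import Relation.Binary.PropositionalEquality using (_≢_)

data Form (n : ℕ) (P : Set) : Set where
  var  : P → Form n P
  ¬'_  : Form n P → Form n P
  _∧'_ : Form n P → Form n P → Form n P
  □    : Fin n → Form n P → Form n P
  ∀'   : Fin n → Form n P → Form n P

◇ : ∀ {n P} → Fin n → Form n P → Form n P
◇ a φ = ¬' □ a (¬' φ)

∃' : ∀ {n P} → Fin n → Form n P → Form n P
∃' a φ = ¬' ∀' a (¬' φ)

_⇒'_ : ∀ {n P} → Form n P → Form n P → Form n P
φ ⇒' ψ = ¬' (φ ∧' (¬' ψ))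

_⇔'_ : ∀ {n P} → Form n P → Form n P → Form n P
φ ⇔' ψ = (φ ⇒' ψ) ∧' (ψ ⇒' φ)

record Model (n : ℕ) (P : Set) : Set₁ where
  field
    S : Set
    R : Fin n → S → S → Set
    V : P → S → Set
open Model public

-- M_s ⪰_a M'_s' : existence of a relation 𝔉 ⊆ S × S' containing (s,s')
-- (hence nonempty) satisfying atoms, back for all agents, forth for agents ≠ a.
Refines : ∀ {n P} → Fin n → (M : Model n P) → S M → (M' : Model n P) → S M' → Set₁
Refines {n} {P} a M s M' s' =
  Σ (S M → S M' → Set) λ F →
    F s s' ×
    (∀ u u' → F u u' →
       (∀ (p : P) → (V M p u → V M' p u') × (V M' p u' → V M p u))
     × (∀ (b : Fin n) v' → R M' b u' v' → Σ (S M) λ v → R M b u v × F v v')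
     × (∀ (b : Fin n) → b ≢ a → ∀ v → R M b u v → Σ (S M') λ v' → R M' b u' v' × F v v'))

_,_⊨_ : ∀ {n P} → (M : Model n P) → S M → Form n P → Set₁
M , s ⊨ var p = Lift (lsuc lzero) (V M p s)
M , s ⊨ (¬' φ) = (M , s ⊨ φ) → ⊥
M , s ⊨ (φ ∧' ψ) = (M , s ⊨ φ) × (M , s ⊨ ψ)
M , s ⊨ □ a φ = ∀ t → R M a s t → M , t ⊨ φ
_,_⊨_ {n} {P} M s (∀' a φ) = ∀ (M' : Model n P) (s' : S M') → Refines a M s M' s' → M' , s' ⊨ φ

Valid : ∀ {n P} → Form n P → Set₁
Valid {n} {P} φ = ∀ (M : Model n P) (s : S M) → M , s ⊨ φ

-- ⪰_a is a preorder (reflexivity gives (i), transitivity gives (ii)) whose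
-- quantifier cannot distinguish bisimilar models.  Two a-refinements of the same
-- pointed model have a common a-refinement, built on the pairs of states related
-- to a common ancestor; this confluence gives (iii).  In (iv), left to right is
-- the back condition at the root.  Right to left, an a-refinement M'_t' of an
-- a-successor t of s is grafted onto M by one new a-edge from s to a disjoint
-- copy of M'.
module Submission where

open import Defs
open import Level using (lift)
open import Data.Nat using (ℕ)
open import Data.Fin using (Fin)
open import Data.Product using (Σ; _×_; _,_; proj₁)
open import Data.Sum using (_⊎_; inj₁; inj₂)
open import Data.Empty using (⊥)
open import Function using (id)
open import Relation.Binary.PropositionalEquality using (_≡_; refl; _≢_)

variable
  n : ℕ
  P : Set
  a : Fin n
  M M₁ M₂ N : Model n P

SameAtoms : (M N : Model n P) → S M → S N → Set
SameAtoms {P = P} M N u v = ∀ (p : P) → (V M p u → V N p v) × (V N p v → V M p u)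

Back : (b : Fin n) (M N : Model n P) → (S M → S N → Set) → S M → S N → Set
Back b M N F u v = ∀ v' → R N b v v' → Σ (S M) λ u' → R M b u u' × F u' v'

Forth : (b : Fin n) (M N : Model n P) → (S M → S N → Set) → S M → S N → Set
Forth b M N F u v = ∀ u' → R M b u u' → Σ (S N) λ v' → R N b v v' × F u' v'

-- Refines a M s N t unfolds to Σ F (F s t × IsRefinement a M N F).
IsRefinement : Fin n → (M N : Model n P) → (S M → S N → Set) → Set
IsRefinement a M N F =
  ∀ u v → F u v → SameAtoms M N u v × (∀ b → Back b M N F u v) × (∀ b → b ≢ a → Forth b M N F u v)

IsBisimulation : (M N : Model n P) → (S M → S N → Set) → Set
IsBisimulation M N Z =
  ∀ u v → Z u v → SameAtoms M N u v × (∀ b → Back b M N Z u v) × (∀ b → Forth b M N Z u v)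

Bisimilar : (M : Model n P) → S M → (N : Model n P) → S N → Set₁
Bisimilar M s N t = Σ (S M → S N → Set) λ Z → Z s t × IsBisimulation M N Z

sameAtoms-refl : ∀ (M : Model n P) u → SameAtoms M M u u
sameAtoms-refl M u p = id , id

sameAtoms-sym : ∀ {u v} → SameAtoms M N u v → SameAtoms N M v u
sameAtoms-sym eq p = let (to , from) = eq p in from , to

sameAtoms-trans : ∀ {u v w} → SameAtoms M₁ M u v → SameAtoms M M₂ v w → SameAtoms M₁ M₂ u w
sameAtoms-trans eq₁ eq₂ p =
  let (to₁ , from₁) = eq₁ p ; (to₂ , from₂) = eq₂ p in
  (λ h → to₂ (to₁ h)) , (λ h → from₁ (from₂ h))

bisimilar-sym : ∀ {s t} → Bisimilar M s N t → Bisimilar N t M s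
bisimilar-sym {M = M} {N = N} (Z , z , bisim) = (λ v u → Z u v) , z , λ v u zuv →
  let (atoms , back , forth) = bisim u v zuv in sameAtoms-sym {M = M} {N = N} atoms , forth , back

bisimilar⇒refines : ∀ {s t} → Bisimilar M s N t → Refines a M s N t
bisimilar⇒refines (Z , z , bisim) = Z , z , λ u v zuv →
  let (atoms , back , forth) = bisim u v zuv in atoms , back , λ b _ → forth b

refines-refl : ∀ (M : Model n P) s → Refines a M s M s
refines-refl M s = _≡_ , refl , λ { u .u refl →
  sameAtoms-refl M u , (λ b v r → v , r , refl) , λ b _ v r → v , r , refl }

refines-trans : ∀ {s₁ s t} → Refines a M₁ s₁ M s → Refines a M s M₂ t → Refines a M₁ s₁ M₂ t
refines-trans {M₁ = M₁} {M = M} {M₂ = M₂} (F₁ , f₁ , ρ₁) (F₂ , f₂ , ρ₂) =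
  (λ u w → Σ (S M) λ v → F₁ u v × F₂ v w) , (_ , f₁ , f₂) ,
  λ u w (v , fuv , fvw) →
    let (atoms₁ , back₁ , forth₁) = ρ₁ u v fuv
        (atoms₂ , back₂ , forth₂) = ρ₂ v w fvw in
    sameAtoms-trans {M₁ = M₁} {M = M} {M₂ = M₂} atoms₁ atoms₂ ,
    (λ b w' rw → let (v' , rv , fvw') = back₂ b w' rw
                     (u' , ru , fuv') = back₁ b v' rv in u' , ru , v' , fuv' , fvw') ,
    (λ b b≢a u' ru → let (v' , rv , fuv') = forth₁ b b≢a u' ru
                         (w' , rw , fvw') = forth₂ b b≢a v' rv in w' , rw , v' , fuv' , fvw')

refines-back : ∀ {s s'} → Refines a M s N s' → ∀ t' → R N a s' t' →
               Σ (S M) λ t → R M a s t × Refines a M t N t'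
refines-back {a = a} {s = s} {s'} (F , f , ρ) t' r =
  let (_ , back , _) = ρ s s' f ; (t , rt , ft) = back a t' r in t , rt , F , ft , ρ

⊨-bisimilar : ∀ {s t} (φ : Form n P) → Bisimilar M s N t → M , s ⊨ φ → N , t ⊨ φ
⊨-bisimilar (var p) (Z , z , bisim) (lift h) =
  let (atoms , _) = bisim _ _ z in lift (proj₁ (atoms p) h)
⊨-bisimilar (¬' φ) bs h h' = h (⊨-bisimilar φ (bisimilar-sym bs) h')
⊨-bisimilar (φ ∧' ψ) bs (h₁ , h₂) = ⊨-bisimilar φ bs h₁ , ⊨-bisimilar ψ bs h₂
⊨-bisimilar (□ a φ) (Z , z , bisim) h t' r =
  let (_ , back , _) = bisim _ _ z ; (t , rt , z') = back a t' r in
  ⊨-bisimilar φ (Z , z' , bisim) (h t rt)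
⊨-bisimilar (∀' a φ) bs h K k r = h K k (refines-trans (bisimilar⇒refines bs) r)

record Joint (M M₁ M₂ : Model n P) (F₁ : S M → S M₁ → Set) (F₂ : S M → S M₂ → Set) : Set where
  constructor joint
  field
    base       : S M
    left       : S M₁
    right      : S M₂
    base-left  : F₁ base left
    base-right : F₂ base right
open Joint

swap : ∀ {F₁ F₂} → Joint M M₁ M₂ F₁ F₂ → Joint M M₂ M₁ F₂ F₁
swap (joint u u₁ u₂ f₁ f₂) = joint u u₂ u₁ f₂ f₁

jointModel : (M M₁ M₂ : Model n P) (F₁ : S M → S M₁ → Set) (F₂ : S M → S M₂ → Set) → Model n P
jointModel M M₁ M₂ F₁ F₂ = record
  { S = Joint M M₁ M₂ F₁ F₂
  ; R = λ b x y → R M b (base x) (base y) × R M₁ b (left x) (left y) × R M₂ b (right x) (right y)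
  ; V = λ p x → V M p (base x)
  }

jointModel-swap : ∀ {F₁ F₂} →
  IsBisimulation (jointModel M M₂ M₁ F₂ F₁) (jointModel M M₁ M₂ F₁ F₂) (λ y x → y ≡ swap x)
jointModel-swap {M = M} _ x refl =
  sameAtoms-refl M (base x) ,
  (λ b x' (r , r₁ , r₂) → swap x' , (r , r₂ , r₁) , refl) ,
  (λ b y' (r , r₂ , r₁) → swap y' , (r , r₁ , r₂) , refl)

jointModel-left : ∀ {F₁ F₂} → IsRefinement a M M₁ F₁ → IsRefinement a M M₂ F₂ →
                  IsRefinement a M₁ (jointModel M M₁ M₂ F₁ F₂) (λ u₁ x → u₁ ≡ left x)
jointModel-left {M = M} {M₁ = M₁} ρ₁ ρ₂ _ (joint u u₁ u₂ f₁ f₂) refl =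
  let (atoms₁ , back₁ , _) = ρ₁ u u₁ f₁ ; (_ , _ , forth₂) = ρ₂ u u₂ f₂ in
  sameAtoms-sym {M = M} {N = M₁} atoms₁ ,
  (λ b y (_ , r₁ , _) → left y , r₁ , refl) ,
  (λ b b≢a v₁ r₁ → let (v , r , g₁) = back₁ b v₁ r₁ ; (v₂ , r₂ , g₂) = forth₂ b b≢a v r in
     joint v v₁ v₂ g₁ g₂ , (r , r₁ , r₂) , refl)

refines-amalgamate : ∀ {s s₁ s₂} → Refines a M s M₁ s₁ → Refines a M s M₂ s₂ →
                     Σ (Model n P) λ N → Σ (S N) λ x → Refines a M₁ s₁ N x × Refines a M₂ s₂ N x
refines-amalgamate {M = M} {M₁ = M₁} {M₂ = M₂} {s} {s₁} {s₂} (F₁ , f₁ , ρ₁) (F₂ , f₂ , ρ₂) =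
  jointModel M M₁ M₂ F₁ F₂ , root ,
  (_ , refl , jointModel-left ρ₁ ρ₂) ,
  -- the right projection is the left projection of the swapped joint model
  refines-trans (_ , refl , jointModel-left ρ₂ ρ₁) (bisimilar⇒refines (_ , refl , jointModel-swap))
  where
  root : Joint M M₁ M₂ F₁ F₂
  root = joint s s₁ s₂ f₁ f₂

module _ (a : Fin n) (M : Model n P) (s : S M) (M' : Model n P) (t' : S M') where

  graftEdge : Fin n → S M ⊎ S M' → S M ⊎ S M' → Set
  graftEdge b (inj₁ u)  (inj₁ v)  = R M b u v
  graftEdge b (inj₁ u)  (inj₂ v') = (b ≡ a) × (u ≡ s) × (v' ≡ t')
  graftEdge b (inj₂ u') (inj₁ v)  = ⊥
  graftEdge b (inj₂ u') (inj₂ v') = R M' b u' v'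

  graftAtom : P → S M ⊎ S M' → Set
  graftAtom p (inj₁ u)  = V M p u
  graftAtom p (inj₂ u') = V M' p u'

  graft : Model n P
  graft = record { S = S M ⊎ S M' ; R = graftEdge ; V = graftAtom }

  graft-edge : R graft a (inj₁ s) (inj₂ t')
  graft-edge = refl , refl , refl

  graft-bisimilar : Bisimilar M' t' graft (inj₂ t')
  graft-bisimilar = Z , refl , bisim
    where
    Z : S M' → S M ⊎ S M' → Set
    Z u' (inj₁ _)  = ⊥
    Z u' (inj₂ v') = u' ≡ v'

    back : ∀ b u' y → graftEdge b (inj₂ u') y → Σ (S M') λ v' → R M' b u' v' × Z v' y
    back b u' (inj₂ v') r = v' , r , refl

    bisim : IsBisimulation M' graft Z
    bisim u' (inj₂ .u') refl =
      sameAtoms-refl M' u' , (λ b → back b u') , λ b v' r → inj₂ v' , r , refl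

  graft-refines : ∀ {t} → R M a s t → Refines a M t M' t' → Refines a M s graft (inj₁ s)
  graft-refines {t} rt (F , f , ρ) = G , refl , ρ'
    where
    G : S M → S M ⊎ S M' → Set
    G u (inj₁ v)  = u ≡ v
    G u (inj₂ v') = F u v'

    ρ' : IsRefinement a M graft G
    ρ' u (inj₁ .u) refl = sameAtoms-refl M u , back-inj₁ , λ b _ v r → inj₁ v , r , refl
      where
      back-inj₁ : ∀ b y → graftEdge b (inj₁ u) y → Σ (S M) λ v → R M b u v × G v y
      back-inj₁ b (inj₁ v) r = v , r , refl
      back-inj₁ .a (inj₂ .t') (refl , refl , refl) = t , rt , f
    ρ' u (inj₂ u') fuu' =
      let (atoms , back , forth) = ρ u u' fuu' in
      atoms , (λ b → back-inj₂ b (back b)) ,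
      λ b b≢a v r → let (v' , r' , g) = forth b b≢a v r in inj₂ v' , r' , g
      where
      back-inj₂ : ∀ b → Back b M M' F u u' →
                  ∀ y → graftEdge b (inj₂ u') y → Σ (S M) λ v → R M b u v × G v y
      back-inj₂ b back (inj₂ v') r = back v' r

∃'-intro : ∀ {φ : Form n P} {s t} → Refines a M s N t → N , t ⊨ φ → M , s ⊨ ∃' a φ
∃'-intro r h none = none _ _ r h

◇-intro : ∀ {φ : Form n P} {s t} → R M a s t → M , t ⊨ φ → M , s ⊨ ◇ a φ
◇-intro r h box = box _ r h

module _ (a : Fin n) (φ : Form n P) where

  ∀'-elim : Valid (∀' a φ ⇒' φ)
  ∀'-elim M s (h , ¬φ) = ¬φ (h M s (refines-refl M s))

  ∀'-twice : Valid (∀' a φ ⇒' ∀' a (∀' a φ))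
  ∀'-twice M s (h , ¬h) = ¬h λ _ _ r₁ _ _ r₂ → h _ _ (refines-trans r₁ r₂)

  ∃'∀'⇒∀'∃' : Valid (∃' a (∀' a φ) ⇒' ∀' a (∃' a φ))
  ∃'∀'⇒∀'∃' M s (h , ¬h) = ¬h λ _ _ r₁ none → h λ _ _ r₂ all →
    let (N , x , r₁' , r₂') = refines-amalgamate r₁ r₂ in ∃'-intro r₁' (all N x r₂') none

  ∃'◇⇒◇∃' : Valid (∃' a (◇ a φ) ⇒' ◇ a (∃' a φ))
  ∃'◇⇒◇∃' M s (h , ¬h) = ¬h λ box → h λ _ _ r ◇φ → ◇φ λ t' r' φt' →
    let (t , rt , ref-t) = refines-back r t' r' in box t rt (∃'-intro ref-t φt')

  ◇∃'⇒∃'◇ : Valid (◇ a (∃' a φ) ⇒' ∃' a (◇ a φ))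
  ◇∃'⇒∃'◇ M s (h , ¬h) = ¬h λ none → h λ t rt ∃φ → ∃φ λ M' t' r φt' →
    ∃'-intro {φ = ◇ a φ} (graft-refines a M s M' t' rt r)
             (◇-intro {φ = φ} {s = inj₁ s} (graft-edge a M s M' t')
                      (⊨-bisimilar φ (graft-bisimilar a M s M' t') φt'))
             none

proposition8 : ∀ (n : ℕ) (P : Set) (a : Fin n) (φ : Form n P) →
    Valid (∀' a φ ⇒' φ)
  × Valid (∀' a φ ⇒' ∀' a (∀' a φ))
  × Valid (∃' a (∀' a φ) ⇒' ∀' a (∃' a φ))
  × Valid (∃' a (◇ a φ) ⇔' ◇ a (∃' a φ))
proposition8 n P a φ =
    ∀'-elim a φ
  , ∀'-twice a φ
  , ∃'∀'⇒∀'∃' a φ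
  , λ M s → ∃'◇⇒◇∃' a φ M s , ◇∃'⇒∃'◇ a φ M s
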